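{- Let $\Gamma,\Delta$ be contexts, let $\rho:\Gamma\to\Delta$ be a renaming, let $P$ be a process with $\Gamma\vdash P$, let $a$ be an action with $a:\mathsf{Action}\,\Gamma$, and let $E: P\xrightarrow{a} Q$ be a transition. Then there exists a transition $\rho^{*}P \xrightarrow{\rho^{*}a} (\rho/a)^{*}Q$, where $\rho/a = \rho+1$ if $a$ is a bound action and $\rho/a=\rho$ if $a$ is a non-bound action.
   Context: Names are de Bruijn indices $0,1,2,\dots$. A context $\Gamma$ is a natural number, identified with the set $\{0,\dots,\Gamma-1\}$; $\Gamma+1$ is its extension. Processes: $P,Q::= 0 \mid x.P \mid \overline{x}\langle y\rangle.P \mid P+Q \mid P\mid Q \mid \nu P \mid\ !P$ (inactive, input on $x$ binding index $0$ in $P$, output of $y$ on $x$, choice, parallel, restriction binding index $0$, replication). Well-scopedness $\Gamma\vdash P$: $\Gamma\vdash 0$; $\Gamma\vdash x.P$ if $x\in\Gamma$ and $\Gamma+1\vdash P$; $\Gamma\vdash \overline{x}\langle y\rangle.P$ if $x,y\in\Gamma$ and $\Gamma\vdash P$; $\Gamma\vdash P+Q$ and $\Gamma\vdash P\mid Q$ if $\Gamma\vdash P$ and $\Gamma\vdash Q$; $\Gamma\vdash\nu P$ if $\Gamma+1\vdash P$; $\Gamma\vdash !P$ if $\Gamma\vdash P$. Actions $a:\mathsf{Action}\,\Gamma$: input $x$ and bound output $\overline{x}$ (for $x\in\Gamma$) are the bound actions, with target context $\Gamma+1$; output $\overline{x}\langle y\rangle$ (for $x,y\in\Gamma$) and $\tau$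 are the non-bound actions, with target context $\Gamma$. Below $b$ ranges over bound and $c$ over non-bound actions. A renaming $\rho:\Gamma\to\Delta$ is any function. Define $\mathsf{push}:\Gamma\to\Gamma+1$, $\mathsf{push}\,x=x+1$; $\mathsf{pop}\,y:\Gamma+1\to\Gamma$ (for $y\in\Gamma$), $\mathsf{pop}\,y\,0=y$, $\mathsf{pop}\,y\,(x+1)=x$; $\mathsf{swap}:\Gamma+2\to\Gamma+2$ exchanging $0$ and $1$ and fixing $x+2$; and $\rho+1:\Gamma+1\to\Delta+1$ by $(\rho+1)0=0$, $(\rho+1)(x+1)=\rho x+1$ (and $\rho+k$ by iteration). The action $\rho^{*}$ on processes: $\rho^*0=0$, $\rho^*(x.P)=(\rho x).((\rho+1)^*P)$, $\rho^*(\overline{x}\langle y\rangle.P)=\overline{\rho x}\langle\rho y\rangle.\rho^*P$, $\rho^*(P+Q)=\rho^*P+\rho^*Q$, $\rho^*(P\mid Q)=\rho^*P\mid\rho^*Q$, $\rho^*(\nu P)=\nu((\rho+1)^*P)$, $\rho^*(!P)=!\rho^*P$; on actions: $\rho^*x=\rho x$ (input), $\rho^*\overline{x}=\overline{\rho x}$, $\rho^*\tau=\tau$, $\rho^*\overline{x}\langle y\rangle=\overline{\rho x}\langle \rho y\rangle$. Transitions $P\xrightarrow{a}R$ (with $\Gamma\vdash P$, $a:\mathsf{Action}\,\Gamma$ and $R$ scoped in the target context of $a$) are inductively generated by: $x.P\xrightarrow{x}P$; $\overline{x}\langle y\rangle.P\xrightarrow{\overline{x}\langle y\rangle}P$; if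 $P\xrightarrow{a}R$ then $P+Q\xrightarrow{a}R$, and if $Q\xrightarrow{a}S$ then $P+Q\xrightarrow{a}S$; if $P\xrightarrow{c}R$ then $P\mid Q\xrightarrow{c}R\mid Q$; if $P\xrightarrow{b}R$ then $P\mid Q\xrightarrow{b}R\mid \mathsf{push}^*Q$; if $Q\xrightarrow{c}S$ then $P\mid Q\xrightarrow{c}P\mid S$; if $Q\xrightarrow{b}S$ then $P\mid Q\xrightarrow{b}\mathsf{push}^*P\mid S$; if $P\xrightarrow{x}R$ and $Q\xrightarrow{\overline{x}\langle y\rangle}S$ then $P\mid Q\xrightarrow{\tau}(\mathsf{pop}\,y)^*R\mid S$; if $P\xrightarrow{\overline{x}\langle y\rangle}R$ and $Q\xrightarrow{x}S$ then $P\mid Q\xrightarrow{\tau}R\mid(\mathsf{pop}\,y)^*S$; if $P\xrightarrow{\overline{x+1}\langle 0\rangle}R$ then $\nu P\xrightarrow{\overline{x}}R$; if $P\xrightarrow{x}R$ and $Q\xrightarrow{\overline{x}}S$ then $P\mid Q\xrightarrow{\tau}\nu(R\mid S)$; if $P\xrightarrow{\overline{x}}R$ and $Q\xrightarrow{x}S$ then $P\mid Q\xrightarrow{\tau}\nu(R\mid S)$; if $P\xrightarrow{\mathsf{push}^*c}R$ then $\nu P\xrightarrow{c}\nu R$; if $P\xrightarrow{\mathsf{push}^*b}R$ then $\nu P\xrightarrow{b}\nu(\mathsf{swap}^*R)$; if $P\mid !P\xrightarrow{a}R$ then $!P\xrightarrow{a}R$. -}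

module Defs where

open import Data.Nat using (ℕ; zero; suc)
open import Data.Fin using (Fin; zero; suc)
open import Data.Product using (Σ; _,_)

-- Names are de Bruijn indices: a context Γ is a natural number,
-- names in Γ are elements of Fin Γ; Γ + 1 is suc Γ.

-- Intrinsically well-scoped processes: Process Γ is the set of P with Γ ⊢ P.
infixr 5 _⊕_
infixr 6 _∥_
infix 9 !_
infixr 8 _∙_ _⟨_⟩∙_

data Process (Γ : ℕ) : Set where
  𝟘     : Process Γ
  _∙_   : Fin Γ → Process (suc Γ) → Process Γ
  _⟨_⟩∙_ : Fin Γ → Fin Γ → Process Γ → Process Γ
  _⊕_   : Process Γ → Process Γ → Process Γ
  _∥_   : Process Γ → Process Γ → Process Γ
  ν     : Process (suc Γ) → Process Γ
  !_    : Process Γ → Process Γ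

data BAction (Γ : ℕ) : Set where
  inp  : Fin Γ → BAction Γ
  bout : Fin Γ → BAction Γ

data NBAction (Γ : ℕ) : Set where
  out : Fin Γ → Fin Γ → NBAction Γ
  τ   : NBAction Γ

data Action (Γ : ℕ) : Set where
  bound    : BAction Γ → Action Γ
  nonbound : NBAction Γ → Action Γ

target : ∀ {Γ} → Action Γ → ℕ
target {Γ} (bound _)    = suc Γ
target {Γ} (nonbound _) = Γ

Ren : ℕ → ℕ → Set
Ren Γ Δ = Fin Γ → Fin Δ

push : ∀ {Γ} → Ren Γ (suc Γ)
push x = suc x

pop : ∀ {Γ} → Fin Γ → Ren (suc Γ) Γ
pop y zero    = y
pop y (suc x) = x

swap : ∀ {Γ} → Ren (suc (suc Γ)) (suc (suc Γ))
swap zero          = suc zero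
swap (suc zero)    = zero
swap (suc (suc x)) = suc (suc x)

lift : ∀ {Γ Δ} → Ren Γ Δ → Ren (suc Γ) (suc Δ)
lift ρ zero    = zero
lift ρ (suc x) = suc (ρ x)

ren : ∀ {Γ Δ} → Ren Γ Δ → Process Γ → Process Δ
ren ρ 𝟘             = 𝟘
ren ρ (x ∙ P)       = ρ x ∙ ren (lift ρ) P
ren ρ (x ⟨ y ⟩∙ P)  = ρ x ⟨ ρ y ⟩∙ ren ρ P
ren ρ (P ⊕ Q)       = ren ρ P ⊕ ren ρ Q
ren ρ (P ∥ Q)       = ren ρ P ∥ ren ρ Q
ren ρ (ν P)         = ν (ren (lift ρ) P)
ren ρ (! P)         = ! ren ρ P

renB : ∀ {Γ Δ} → Ren Γ Δ → BAction Γ → BAction Δ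
renB ρ (inp x)  = inp (ρ x)
renB ρ (bout x) = bout (ρ x)

renNB : ∀ {Γ Δ} → Ren Γ Δ → NBAction Γ → NBAction Δ
renNB ρ (out x y) = out (ρ x) (ρ y)
renNB ρ τ         = τ

renA : ∀ {Γ Δ} → Ren Γ Δ → Action Γ → Action Δ
renA ρ (bound b)    = bound (renB ρ b)
renA ρ (nonbound c) = nonbound (renNB ρ c)

_/_ : ∀ {Γ Δ} (ρ : Ren Γ Δ) (a : Action Γ) → Ren (target a) (target (renA ρ a))
ρ / bound _    = lift ρ
ρ / nonbound _ = ρ

infix 4 _—[_]→_
data _—[_]→_ {Γ : ℕ} : Process Γ → (a : Action Γ) → Process (target a) → Set where
  inp-rule : ∀ {x P} → (x ∙ P) —[ bound (inp x) ]→ P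
  out-rule : ∀ {x y P} → (x ⟨ y ⟩∙ P) —[ nonbound (out x y) ]→ P
  sumL : ∀ {P Q a R} → P —[ a ]→ R → (P ⊕ Q) —[ a ]→ R
  sumR : ∀ {P Q a S} → Q —[ a ]→ S → (P ⊕ Q) —[ a ]→ S
  parL-nb : ∀ {P Q c R} → P —[ nonbound c ]→ R → (P ∥ Q) —[ nonbound c ]→ (R ∥ Q)
  parL-b  : ∀ {P Q b R} → P —[ bound b ]→ R → (P ∥ Q) —[ bound b ]→ (R ∥ ren push Q)
  parR-nb : ∀ {P Q c S} → Q —[ nonbound c ]→ S → (P ∥ Q) —[ nonbound c ]→ (P ∥ S)
  parR-b  : ∀ {P Q b S} → Q —[ bound b ]→ S → (P ∥ Q) —[ bound b ]→ (ren push P ∥ S)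
  comm-io : ∀ {P Q x y R S} → P —[ bound (inp x) ]→ R → Q —[ nonbound (out x y) ]→ S
          → (P ∥ Q) —[ nonbound τ ]→ (ren (pop y) R ∥ S)
  comm-oi : ∀ {P Q x y R S} → P —[ nonbound (out x y) ]→ R → Q —[ bound (inp x) ]→ S
          → (P ∥ Q) —[ nonbound τ ]→ (R ∥ ren (pop y) S)
  open-rule : ∀ {P x R} → P —[ nonbound (out (suc x) zero) ]→ R → ν P —[ bound (bout x) ]→ R
  close-io : ∀ {P Q x R S} → P —[ bound (inp x) ]→ R → Q —[ bound (bout x) ]→ S
           → (P ∥ Q) —[ nonbound τ ]→ ν (R ∥ S)
  close-oi : ∀ {P Q x R S} → P —[ bound (bout x) ]→ R → Q —[ bound (inp x) ]→ S
           → (P ∥ Q) —[ nonbound τ ]→ ν (R ∥ S)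
  res-nb : ∀ {P c R} → P —[ nonbound (renNB push c) ]→ R → ν P —[ nonbound c ]→ ν R
  res-b  : ∀ {P b R} → P —[ bound (renB push b) ]→ R → ν P —[ bound b ]→ ν (ren swap R)
  rep : ∀ {P a R} → (P ∥ ! P) —[ a ]→ R → ! P —[ a ]→ R

-- Every rule is preserved verbatim by renaming,
-- except that the targets of parL-b/parR-b, comm-io/comm-oi and res-b apply
-- push, pop y and swap; there one only needs that ρ commutes with these
-- structural renamings (push ∘ ρ = (ρ + 1) ∘ push, ρ ∘ pop y = pop (ρ y) ∘ (ρ + 1),
-- (ρ + 2) ∘ swap = swap ∘ (ρ + 2)), which lifts to processes by functoriality of ren.
module Submission where

open import Defs
open import Data.Nat using (ℕ)
open import Data.Fin using (Fin; zero; suc)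
open import Function using (_∘_)
open import Relation.Binary.PropositionalEquality
  using (_≡_; refl; sym; trans; cong; cong₂; _≗_)

lift-cong : ∀ {Γ Δ} {ρ σ : Ren Γ Δ} → ρ ≗ σ → lift ρ ≗ lift σ
lift-cong ρ≗σ zero    = refl
lift-cong ρ≗σ (suc x) = cong suc (ρ≗σ x)

ren-cong : ∀ {Γ Δ} {ρ σ : Ren Γ Δ} → ρ ≗ σ → ren ρ ≗ ren σ
ren-cong ρ≗σ 𝟘            = refl
ren-cong ρ≗σ (x ∙ P)      = cong₂ _∙_ (ρ≗σ x) (ren-cong (lift-cong ρ≗σ) P)
ren-cong {ρ = ρ} {σ} ρ≗σ (x ⟨ y ⟩∙ P) =
  trans (cong₂ (_⟨_⟩∙ ren ρ P) (ρ≗σ x) (ρ≗σ y)) (cong (σ x ⟨ σ y ⟩∙_) (ren-cong ρ≗σ P))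
ren-cong ρ≗σ (P ⊕ Q)      = cong₂ _⊕_ (ren-cong ρ≗σ P) (ren-cong ρ≗σ Q)
ren-cong ρ≗σ (P ∥ Q)      = cong₂ _∥_ (ren-cong ρ≗σ P) (ren-cong ρ≗σ Q)
ren-cong ρ≗σ (ν P)        = cong ν (ren-cong (lift-cong ρ≗σ) P)
ren-cong ρ≗σ (! P)        = cong !_ (ren-cong ρ≗σ P)

lift-∘ : ∀ {A B C} (ρ : Ren B C) (σ : Ren A B) → lift ρ ∘ lift σ ≗ lift (ρ ∘ σ)
lift-∘ ρ σ zero    = refl
lift-∘ ρ σ (suc x) = refl

ren-∘ : ∀ {A B C} (ρ : Ren B C) (σ : Ren A B) → ren ρ ∘ ren σ ≗ ren (ρ ∘ σ)

ren-lift-∘ : ∀ {A B C} (ρ : Ren B C) (σ : Ren A B)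
           → ren (lift ρ) ∘ ren (lift σ) ≗ ren (lift (ρ ∘ σ))
ren-lift-∘ ρ σ P = trans (ren-∘ (lift ρ) (lift σ) P) (ren-cong (lift-∘ ρ σ) P)

ren-∘ ρ σ 𝟘            = refl
ren-∘ ρ σ (x ∙ P)      = cong (ρ (σ x) ∙_) (ren-lift-∘ ρ σ P)
ren-∘ ρ σ (x ⟨ y ⟩∙ P) = cong (ρ (σ x) ⟨ ρ (σ y) ⟩∙_) (ren-∘ ρ σ P)
ren-∘ ρ σ (P ⊕ Q)      = cong₂ _⊕_ (ren-∘ ρ σ P) (ren-∘ ρ σ Q)
ren-∘ ρ σ (P ∥ Q)      = cong₂ _∥_ (ren-∘ ρ σ P) (ren-∘ ρ σ Q)
ren-∘ ρ σ (ν P)        = cong ν (ren-lift-∘ ρ σ P)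
ren-∘ ρ σ (! P)        = cong !_ (ren-∘ ρ σ P)

ren-square : ∀ {A B B′ C} {ρ : Ren B C} {σ : Ren A B} {σ′ : Ren B′ C} {ρ′ : Ren A B′}
           → ρ ∘ σ ≗ σ′ ∘ ρ′ → ren ρ ∘ ren σ ≗ ren σ′ ∘ ren ρ′
ren-square {ρ = ρ} {σ} {σ′} {ρ′} square P =
  trans (ren-∘ ρ σ P) (trans (ren-cong square P) (sym (ren-∘ σ′ ρ′ P)))

pop-lift : ∀ {Γ Δ} (ρ : Ren Γ Δ) (y : Fin Γ) → ρ ∘ pop y ≗ pop (ρ y) ∘ lift ρ
pop-lift ρ y zero    = refl
pop-lift ρ y (suc x) = refl

swap-lift : ∀ {Γ Δ} (ρ : Ren Γ Δ) → lift (lift ρ) ∘ swap ≗ swap ∘ lift (lift ρ)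
swap-lift ρ zero          = refl
swap-lift ρ (suc zero)    = refl
swap-lift ρ (suc (suc x)) = refl

ren-push-lift : ∀ {Γ Δ} (ρ : Ren Γ Δ) → ren push ∘ ren ρ ≗ ren (lift ρ) ∘ ren push
ren-push-lift ρ = ren-square (λ _ → refl)

ren-pop-lift : ∀ {Γ Δ} (ρ : Ren Γ Δ) (y : Fin Γ)
             → ren (pop (ρ y)) ∘ ren (lift ρ) ≗ ren ρ ∘ ren (pop y)
ren-pop-lift ρ y P = sym (ren-square (pop-lift ρ y) P)

ren-swap-lift : ∀ {Γ Δ} (ρ : Ren Γ Δ)
              → ren swap ∘ ren (lift (lift ρ)) ≗ ren (lift (lift ρ)) ∘ ren swap
ren-swap-lift ρ P = sym (ren-square (swap-lift ρ) P)

target-≡ : ∀ {Γ} {P : Process Γ} {a : Action Γ} {R R′ : Process (target a)}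
         → R ≡ R′ → P —[ a ]→ R → P —[ a ]→ R′
target-≡ refl E = E

lemma9 : {Γ Δ : ℕ} (ρ : Ren Γ Δ) {P : Process Γ} {a : Action Γ} {Q : Process (target a)}
    → P —[ a ]→ Q
    → ren ρ P —[ renA ρ a ]→ ren (ρ / a) Q
lemma9 ρ inp-rule     = inp-rule
lemma9 ρ out-rule     = out-rule
lemma9 ρ (sumL E)     = sumL (lemma9 ρ E)
lemma9 ρ (sumR E)     = sumR (lemma9 ρ E)
lemma9 ρ (parL-nb E)  = parL-nb (lemma9 ρ E)
lemma9 ρ (parR-nb E)  = parR-nb (lemma9 ρ E)
lemma9 ρ (parL-b {Q = Q} E) =
  target-≡ (cong (_ ∥_) (ren-push-lift ρ Q)) (parL-b (lemma9 ρ E))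
lemma9 ρ (parR-b {P = P} E) =
  target-≡ (cong (_∥ _) (ren-push-lift ρ P)) (parR-b (lemma9 ρ E))
lemma9 ρ (comm-io {y = y} {R = R} E F) =
  target-≡ (cong (_∥ _) (ren-pop-lift ρ y R)) (comm-io (lemma9 ρ E) (lemma9 ρ F))
lemma9 ρ (comm-oi {y = y} {S = S} E F) =
  target-≡ (cong (_ ∥_) (ren-pop-lift ρ y S)) (comm-oi (lemma9 ρ E) (lemma9 ρ F))
lemma9 ρ (open-rule E) = open-rule (lemma9 (lift ρ) E)
lemma9 ρ (close-io E F) = close-io (lemma9 ρ E) (lemma9 ρ F)
lemma9 ρ (close-oi E F) = close-oi (lemma9 ρ E) (lemma9 ρ F)
-- The action is split so that renNB (lift ρ) (renNB push c) computes to
-- renNB push (renNB ρ c), as res-nb and res-b demand; likewise for renB.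
lemma9 ρ (res-nb {c = out x y} E) = res-nb (lemma9 (lift ρ) E)
lemma9 ρ (res-nb {c = τ} E)       = res-nb (lemma9 (lift ρ) E)
lemma9 ρ (res-b {b = inp x} {R = R} E) =
  target-≡ (cong ν (ren-swap-lift ρ R)) (res-b (lemma9 (lift ρ) E))
lemma9 ρ (res-b {b = bout x} {R = R} E) =
  target-≡ (cong ν (ren-swap-lift ρ R)) (res-b (lemma9 (lift ρ) E))
lemma9 ρ (rep E) = rep (lemma9 ρ E)
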